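{- Let $n\ge 4$ and $0\le m<\binom n2$. Then $\Theta_n(m+1)\le\Theta_n(m)+1$.
   Context: All graphs are finite, simple and undirected. A clique cover of $G=(V,E)$ is a family of vertex sets, each inducing a clique, whose union is $V$ and such that every edge lies in some member. $\theta(G)$ is the minimum size of a clique cover of $G$. For $0\le m\le\binom n2$, $\Theta_n(m)$ is the maximum of $\theta(G)$ over all graphs $G$ with $n$ vertices and $m$ edges. -}

module Defs where

open import Data.Nat using (ℕ; _≤_; _<ᵇ_)
open import Data.Bool using (Bool; true; false; _∧_; if_then_else_)
open import Data.Fin using (Fin; toℕ)
open import Data.Fin.Subset using (Subset; _∈_)
open import Data.List using (List; map; allFin)
open import Data.Nat.ListAction using (sum)
open import Data.Product using (Σ; ∃; _×_)
open import Relation.Binary.PropositionalEquality using (_≡_; _≢_)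

record Graph (n : ℕ) : Set where
  field
    adj    : Fin n → Fin n → Bool
    sym    : ∀ i j → adj i j ≡ adj j i
    irrefl : ∀ i → adj i i ≡ false

open Graph public

Adj : ∀ {n} → Graph n → Fin n → Fin n → Set
Adj G i j = adj G i j ≡ true

edgeCount : ∀ {n} → Graph n → ℕ
edgeCount {n} G =
  sum (map (λ i → sum (map (λ j → if (toℕ i <ᵇ toℕ j) ∧ adj G i j then 1 else 0)
                            (allFin n)))
           (allFin n))

record CliqueCover {n : ℕ} (G : Graph n) (k : ℕ) : Set where
  field
    member     : Fin k → Subset n
    isClique   : ∀ c i j → i ∈ member c → j ∈ member c → i ≢ j → Adj G i j
    coversV    : ∀ v → ∃ λ c → v ∈ member c
    coversE    : ∀ i j → Adj G i j → ∃ λ c → (i ∈ member c) × (j ∈ member c)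

IsTheta : ∀ {n} → Graph n → ℕ → Set
IsTheta G t = CliqueCover G t × (∀ k → CliqueCover G k → t ≤ k)

IsBigTheta : ℕ → ℕ → ℕ → Set
IsBigTheta n m T =
  (Σ (Graph n) λ G → (edgeCount G ≡ m) × IsTheta G T)
  × (∀ (G : Graph n) t → edgeCount G ≡ m → IsTheta G t → t ≤ T)

-- Deleting one edge uv from a graph G with m + 1 edges leaves a graph with m edges, and any clique cover
-- of G − uv becomes one of G after adding the clique {u, v}. Hence θ(G) ≤ θ(G − uv) + 1 ≤ Θ_n(m) + 1;
-- taking G extremal gives Θ_n(m + 1) ≤ Θ_n(m) + 1. The minimum θ(G − uv) exists only classically, so the
-- argument runs under a double negation, which is discharged because ≤ on ℕ is decidable.
module Submission where

open import Defs hiding (sym)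
open import Data.Nat using (ℕ; _≤_; _<_; _+_)
open import Data.Nat.Combinatorics using (_C_)

open import Data.Bool using (true; false; not; _∧_; if_then_else_)
open import Data.Bool.Properties using (∧-zeroʳ; T-≡; ¬-not)
open import Data.Empty using (⊥-elim)
open import Data.Fin using (Fin; zero; suc; toℕ; combine; remQuot; _≟_)
open import Data.Fin.Subset using (Subset; _∈_; ⁅_⁆; _∪_)
open import Data.Fin.Subset.Properties using (x∈⁅x⁆; x∈⁅y⁆⇒x≡y; x∈p∪q⁺; x∈p∪q⁻)
import Data.Fin.Properties as Fin
open import Data.List using (map; allFin; tabulate)
open import Data.List.Properties using (map-tabulate; tabulate-cong)
open import Data.Nat using (zero; suc; _*_; _<ᵇ_; s≤s)
open import Data.Nat.Induction using (<-rec)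
open import Data.Nat.ListAction using (sum)
open import Data.Nat.Properties using (_≤?_; <-asym; <ᵇ⇒<; <⇒<ᵇ; ≮⇒≥; +-suc; +-comm; suc-injective; 0≢1+n; module ≤-Reasoning)
open import Data.Product using (∃; ∃₂; _×_; _,_; proj₁; proj₂; uncurry)
open import Data.Sum using (_⊎_; inj₁; inj₂)
open import Effect.Monad using (RawMonad)
open import Function using (_∘_; _$_)
open import Function.Bundles using (Equivalence; mk⇔)
open import Relation.Nullary using (¬_; Dec; yes; no; does)
open import Relation.Nullary.Decidable using (does-⇔; dec-true; dec-false; decidable-stable; _×-dec_; _⊎-dec_)
open import Relation.Nullary.Negation using (¬¬-Monad)
open import Relation.Binary.PropositionalEquality
  using (_≡_; _≢_; refl; sym; trans; cong; cong₂; subst; module ≡-Reasoning)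

∑ : ∀ {n} → (Fin n → ℕ) → ℕ
∑ f = sum (tabulate f)

sum-map-allFin : ∀ {n} (f : Fin n → ℕ) → sum (map f (allFin n)) ≡ ∑ f
sum-map-allFin f = cong sum (map-tabulate (λ i → i) f)

∑-cong : ∀ {n} {f g : Fin n → ℕ} → (∀ i → f i ≡ g i) → ∑ f ≡ ∑ g
∑-cong f≗g = cong sum (tabulate-cong f≗g)

∑-zero : ∀ {n} {f : Fin n → ℕ} → (∀ i → f i ≡ 0) → ∑ f ≡ 0
∑-zero {zero}  f≗0 = refl
∑-zero {suc n} f≗0 = cong₂ _+_ (f≗0 zero) (∑-zero (f≗0 ∘ suc))

∑-suc-at : ∀ {n} {f g : Fin n → ℕ} (a : Fin n) → f a ≡ suc (g a) →
           (∀ i → i ≢ a → f i ≡ g i) → ∑ f ≡ suc (∑ g)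
∑-suc-at zero    fa f≗g = cong₂ _+_ fa (∑-cong λ i → f≗g (suc i) λ ())
∑-suc-at {g = g} (suc a) fa f≗g =
  trans (cong₂ _+_ (f≗g zero λ ()) (∑-suc-at a fa λ i i≢a → f≗g (suc i) (i≢a ∘ Fin.suc-injective)))
        (+-suc (g zero) _)

n<ᵇm≡false : ∀ {m n} → m < n → (n <ᵇ m) ≡ false
n<ᵇm≡false {m} {n} m<n = ¬-not λ n<ᵇm → <-asym m<n (<ᵇ⇒< n m (Equivalence.from T-≡ n<ᵇm))

∧≡true⇒ʳ : ∀ {x y} → x ∧ y ≡ true → y ≡ true
∧≡true⇒ʳ {true} y≡true = y≡true

edgeIndicator : ∀ {n} → Graph n → Fin n → Fin n → ℕ
edgeIndicator G i j = if (toℕ i <ᵇ toℕ j) ∧ adj G i j then 1 else 0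

edgeCount≡∑∑ : ∀ {n} (G : Graph n) → edgeCount G ≡ ∑ λ i → ∑ (edgeIndicator G i)
edgeCount≡∑∑ {n} G =
  trans (sum-map-allFin (λ i → sum (map (edgeIndicator G i) (allFin n))))
        (∑-cong λ i → sum-map-allFin (edgeIndicator G i))

edgeIndicator-edge : ∀ {n} (G : Graph n) {i j} → toℕ i < toℕ j → Adj G i j → edgeIndicator G i j ≡ 1
edgeIndicator-edge G {i} {j} i<j ij rewrite Equivalence.to T-≡ (<⇒<ᵇ i<j) | ij = refl

edgeIndicator-nonedge : ∀ {n} (G : Graph n) {i j} → adj G i j ≡ false → edgeIndicator G i j ≡ 0
edgeIndicator-nonedge G {i} {j} ij rewrite ij | ∧-zeroʳ (toℕ i <ᵇ toℕ j) = refl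

edgeIndicator-descending : ∀ {n} (G : Graph n) {i j} → toℕ j < toℕ i → edgeIndicator G i j ≡ 0
edgeIndicator-descending G j<i rewrite n<ᵇm≡false j<i = refl

edgeCount≢0⇒¬¬edge : ∀ {n} (G : Graph n) → edgeCount G ≢ 0 →
                     ¬ ¬ (∃₂ λ u v → toℕ u < toℕ v × Adj G u v)
edgeCount≢0⇒¬¬edge G count≢0 noEdge =
  count≢0 (trans (edgeCount≡∑∑ G) (∑-zero λ i → ∑-zero λ j → indicator≡0 i j))
  where
  indicator≡0 : ∀ i j → edgeIndicator G i j ≡ 0
  indicator≡0 i j with toℕ i <ᵇ toℕ j in i<ᵇj | adj G i j in ij
  ... | true  | true  = ⊥-elim (noEdge (i , j , <ᵇ⇒< _ _ (Equivalence.from T-≡ i<ᵇj) , ij))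
  ... | true  | false = refl
  ... | false | _     = refl

IsPair : ∀ {n} → Fin n → Fin n → Fin n → Fin n → Set
IsPair u v i j = (i ≡ u × j ≡ v) ⊎ (i ≡ v × j ≡ u)

isPair? : ∀ {n} (u v i j : Fin n) → Dec (IsPair u v i j)
isPair? u v i j = (i ≟ u ×-dec j ≟ v) ⊎-dec (i ≟ v ×-dec j ≟ u)

IsPair-sym : ∀ {n} {u v i j : Fin n} → IsPair u v i j → IsPair u v j i
IsPair-sym (inj₁ (i≡u , j≡v)) = inj₂ (j≡v , i≡u)
IsPair-sym (inj₂ (i≡v , j≡u)) = inj₁ (j≡u , i≡v)

isPair?-sym : ∀ {n} (u v i j : Fin n) → does (isPair? u v i j) ≡ does (isPair? u v j i)
isPair?-sym u v i j = does-⇔ (mk⇔ IsPair-sym IsPair-sym) (isPair? u v i j) (isPair? u v j i)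

IsPair-Adj : ∀ {n} (G : Graph n) {u v i j} → Adj G u v → IsPair u v i j → Adj G i j
IsPair-Adj G uv (inj₁ (refl , refl)) = uv
IsPair-Adj G uv (inj₂ (refl , refl)) = trans (Graph.sym G _ _) uv

pairSet : ∀ {n} → Fin n → Fin n → Subset n
pairSet u v = ⁅ u ⁆ ∪ ⁅ v ⁆

IsPair⇒∈pairSet : ∀ {n} {u v i j : Fin n} → IsPair u v i j → i ∈ pairSet u v × j ∈ pairSet u v
IsPair⇒∈pairSet (inj₁ (refl , refl)) = x∈p∪q⁺ (inj₁ (x∈⁅x⁆ _)) , x∈p∪q⁺ (inj₂ (x∈⁅x⁆ _))
IsPair⇒∈pairSet (inj₂ (refl , refl)) = x∈p∪q⁺ (inj₂ (x∈⁅x⁆ _)) , x∈p∪q⁺ (inj₁ (x∈⁅x⁆ _))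

∈pairSet⇒IsPair : ∀ {n} {u v i j : Fin n} → i ∈ pairSet u v → j ∈ pairSet u v → i ≢ j → IsPair u v i j
∈pairSet⇒IsPair {u = u} {v} i∈ j∈ i≢j with x∈p∪q⁻ ⁅ u ⁆ ⁅ v ⁆ i∈ | x∈p∪q⁻ ⁅ u ⁆ ⁅ v ⁆ j∈
... | inj₁ i∈u | inj₂ j∈v = inj₁ (x∈⁅y⁆⇒x≡y _ i∈u , x∈⁅y⁆⇒x≡y _ j∈v)
... | inj₂ i∈v | inj₁ j∈u = inj₂ (x∈⁅y⁆⇒x≡y _ i∈v , x∈⁅y⁆⇒x≡y _ j∈u)
... | inj₁ i∈u | inj₁ j∈u = ⊥-elim (i≢j (trans (x∈⁅y⁆⇒x≡y _ i∈u) (sym (x∈⁅y⁆⇒x≡y _ j∈u))))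
... | inj₂ i∈v | inj₂ j∈v = ⊥-elim (i≢j (trans (x∈⁅y⁆⇒x≡y _ i∈v) (sym (x∈⁅y⁆⇒x≡y _ j∈v))))

edgeOrVertex : ∀ {n} → Graph n → Fin n → Fin n → Subset n
edgeOrVertex G a b = if adj G a b then pairSet a b else ⁅ a ⁆

edgeOrVertexCover : ∀ {n} (G : Graph n) → CliqueCover G (n * n)
edgeOrVertexCover {n} G = record
  { member   = member
  ; isClique = λ c → isClique (remQuot n c)
  ; coversV  = λ a → combine a a , subst (a ∈_) (sym (member-combine a a)) (a∈edgeOrVertex a a)
  ; coversE  = λ a b ab → combine a b
                        , subst (λ S → a ∈ S × b ∈ S) (sym (member-combine a b)) (edge∈edgeOrVertex ab)
  }
  where
  member : Fin (n * n) → Subset n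
  member c = uncurry (edgeOrVertex G) (remQuot n c)

  member-combine : ∀ a b → member (combine a b) ≡ edgeOrVertex G a b
  member-combine a b = cong (uncurry (edgeOrVertex G)) (Fin.remQuot-combine a b)

  a∈edgeOrVertex : ∀ a b → a ∈ edgeOrVertex G a b
  a∈edgeOrVertex a b with adj G a b
  ... | true  = x∈p∪q⁺ (inj₁ (x∈⁅x⁆ a))
  ... | false = x∈⁅x⁆ a

  edge∈edgeOrVertex : ∀ {a b} → Adj G a b → a ∈ edgeOrVertex G a b × b ∈ edgeOrVertex G a b
  edge∈edgeOrVertex ab rewrite ab = IsPair⇒∈pairSet (inj₁ (refl , refl))

  isClique : ∀ ab i j → i ∈ uncurry (edgeOrVertex G) ab → j ∈ uncurry (edgeOrVertex G) ab → i ≢ j → Adj G i j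
  isClique (a , b) i j i∈ j∈ i≢j with adj G a b in ab
  ... | true  = IsPair-Adj G ab (∈pairSet⇒IsPair i∈ j∈ i≢j)
  ... | false = ⊥-elim (i≢j (trans (x∈⁅y⁆⇒x≡y a i∈) (sym (x∈⁅y⁆⇒x≡y a j∈))))

removeEdge : ∀ {n} → Graph n → Fin n → Fin n → Graph n
removeEdge G u v = record
  { adj    = λ i j → not (does (isPair? u v i j)) ∧ adj G i j
  ; sym    = λ i j → cong₂ (λ p a → not p ∧ a) (isPair?-sym u v i j) (Graph.sym G i j)
  ; irrefl = λ i → trans (cong (not (does (isPair? u v i i)) ∧_) (Graph.irrefl G i)) (∧-zeroʳ _)
  }

module _ {n} (G : Graph n) {u v : Fin n} where

  removeEdge-adj : ∀ {i j} → ¬ IsPair u v i j → adj (removeEdge G u v) i j ≡ adj G i j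
  removeEdge-adj {i} {j} ¬p = cong (λ b → not b ∧ adj G i j) (dec-false (isPair? u v i j) ¬p)

  removeEdge-adj-pair : ∀ {i j} → IsPair u v i j → adj (removeEdge G u v) i j ≡ false
  removeEdge-adj-pair {i} {j} p = cong (λ b → not b ∧ adj G i j) (dec-true (isPair? u v i j) p)

  Adj-removeEdge⇒Adj : ∀ {i j} → Adj (removeEdge G u v) i j → Adj G i j
  Adj-removeEdge⇒Adj = ∧≡true⇒ʳ

  edgeIndicator-removeEdge : toℕ u < toℕ v → ∀ {i j} → ¬ (i ≡ u × j ≡ v) →
                             edgeIndicator G i j ≡ edgeIndicator (removeEdge G u v) i j
  edgeIndicator-removeEdge u<v {i} {j} ≢uv with isPair? u v i j
  ... | no ¬p                    = cong (λ b → if (toℕ i <ᵇ toℕ j) ∧ b then 1 else 0) (sym (removeEdge-adj ¬p))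
  ... | yes (inj₁ ≡uv)           = ⊥-elim (≢uv ≡uv)
  ... | yes (inj₂ (refl , refl)) =
    trans (edgeIndicator-descending G u<v) (sym (edgeIndicator-descending (removeEdge G u v) u<v))

  edgeCount-removeEdge : toℕ u < toℕ v → Adj G u v → edgeCount G ≡ suc (edgeCount (removeEdge G u v))
  edgeCount-removeEdge u<v uv = begin
    edgeCount G
      ≡⟨ edgeCount≡∑∑ G ⟩
    ∑ (λ i → ∑ (edgeIndicator G i))
      ≡⟨ ∑-suc-at u (∑-suc-at v indicator-uv row-u) other-rows ⟩
    suc (∑ λ i → ∑ (edgeIndicator (removeEdge G u v) i))
      ≡⟨ cong suc (sym (edgeCount≡∑∑ (removeEdge G u v))) ⟩
    suc (edgeCount (removeEdge G u v))
      ∎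
    where
    open ≡-Reasoning
    indicator-uv : edgeIndicator G u v ≡ suc (edgeIndicator (removeEdge G u v) u v)
    indicator-uv = trans (edgeIndicator-edge G u<v uv)
      (cong suc (sym (edgeIndicator-nonedge (removeEdge G u v) (removeEdge-adj-pair (inj₁ (refl , refl))))))
    row-u : ∀ j → j ≢ v → edgeIndicator G u j ≡ edgeIndicator (removeEdge G u v) u j
    row-u j j≢v = edgeIndicator-removeEdge u<v (j≢v ∘ proj₂)
    other-rows : ∀ i → i ≢ u → ∑ (edgeIndicator G i) ≡ ∑ (edgeIndicator (removeEdge G u v) i)
    other-rows i i≢u = ∑-cong λ j → edgeIndicator-removeEdge u<v {i} {j} (i≢u ∘ proj₁)

  CliqueCover-addEdge : ∀ {k} → Adj G u v → CliqueCover (removeEdge G u v) k → CliqueCover G (suc k)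
  CliqueCover-addEdge {k} uv C = record
    { member   = member
    ; isClique = isClique
    ; coversV  = λ x → let (c , x∈c) = C.coversV x in suc c , x∈c
    ; coversE  = coversE
    }
    where
    module C = CliqueCover C

    member : Fin (suc k) → Subset n
    member zero    = pairSet u v
    member (suc c) = C.member c

    isClique : ∀ c i j → i ∈ member c → j ∈ member c → i ≢ j → Adj G i j
    isClique zero    i j i∈ j∈ i≢j = IsPair-Adj G uv (∈pairSet⇒IsPair i∈ j∈ i≢j)
    isClique (suc c) i j i∈ j∈ i≢j = Adj-removeEdge⇒Adj (C.isClique c i j i∈ j∈ i≢j)

    coversE : ∀ i j → Adj G i j → ∃ λ c → i ∈ member c × j ∈ member c
    coversE i j ij with isPair? u v i j
    ... | yes p = zero , IsPair⇒∈pairSet p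
    ... | no ¬p = let (c , i∈c , j∈c) = C.coversE i j (trans (removeEdge-adj ¬p) ij) in suc c , i∈c , j∈c

  IsTheta-removeEdge : ∀ {t t′} → Adj G u v → IsTheta G t′ → IsTheta (removeEdge G u v) t → t′ ≤ suc t
  IsTheta-removeEdge uv (_ , minimal) (cover , _) = minimal _ (CliqueCover-addEdge uv cover)

¬¬-minimal : (P : ℕ → Set) {k : ℕ} → P k → ¬ ¬ (∃ λ t → P t × (∀ k → P k → t ≤ k))
¬¬-minimal P {k} pk noMinimum = <-rec (λ k → ¬ P k) notBelow k pk
  where
  notBelow : ∀ k → (∀ {j} → j < k → ¬ P j) → ¬ P k
  notBelow k below pk = noMinimum (k , pk , λ j pj → ≮⇒≥ λ j<k → below j<k pj)

¬¬-theta : ∀ {n} (G : Graph n) → ¬ ¬ (∃ (IsTheta G))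
¬¬-theta G = ¬¬-minimal (CliqueCover G) (edgeOrVertexCover G)

claim4 : ∀ (n m T T′ : ℕ) → 4 ≤ n → m < n C 2 →
    IsBigTheta n m T → IsBigTheta n (m + 1) T′ → T′ ≤ T + 1
claim4 n m T T′ _ _ (_ , θ≤T) ((G , countG , θG) , _) = decidable-stable (T′ ≤? T + 1) do
  u , v , u<v , uv ← edgeCount≢0⇒¬¬edge G λ count≡0 → 0≢1+n (trans (sym count≡0) countG′)
  t , θG-uv ← ¬¬-theta (removeEdge G u v)
  let countG-uv = suc-injective (trans (sym (edgeCount-removeEdge G u<v uv)) countG′)
  pure $ begin
    T′    ≤⟨ IsTheta-removeEdge G uv θG θG-uv ⟩
    suc t ≤⟨ s≤s (θ≤T (removeEdge G u v) t countG-uv θG-uv) ⟩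
    suc T ≡⟨ +-comm 1 T ⟩
    T + 1 ∎
  where
  open RawMonad ¬¬-Monad
  open ≤-Reasoning
  countG′ : edgeCount G ≡ suc m
  countG′ = trans countG (+-comm m 1)
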